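{- Let $m,n\geq0$, let $\mathbf{v}\in\mathsf{Shuf}(m,n)$, and let $x\in X$ and $y\in Y$ be arbitrary letters. (1) If $x\notin\mathbf{v}$, then there exists a unique word $\mathbf{u}$ with $\mathbf{u}\lessdot_{\mathsf{bub}}\mathbf{v}$ such that $x\in\mathbf{u}$. (2) If $y\in\mathbf{v}$, then there exists a unique word $\mathbf{u}$ with $\mathbf{u}\lessdot_{\mathsf{bub}}\mathbf{v}$ such that either $y\notin\mathbf{u}$, or $\mathbf{u}_{\mathbf{x}}=\mathbf{v}_{\mathbf{x}}$, $\mathbf{u}_{\mathbf{y}}=\mathbf{v}_{\mathbf{y}}$ and $\mathsf{Inv}(\mathbf{u})=\mathsf{Inv}(\mathbf{v})\setminus\{(x',y)\}$ for $x'$ the letter immediately succeeding $y$ in $\mathbf{v}$.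
   Context: Disjoint alphabets $X=\{x_1,\dots,x_m\}$, $Y=\{y_1,\dots,y_n\}$; $\mathbf{x}=x_1\cdots x_m$, $\mathbf{y}=y_1\cdots y_n$. A word is simple if it has no repeated letter; set notation applied to a word refers to its set of letters; a subword of $w_1\cdots w_k$ is $w_{i_1}\cdots w_{i_l}$ with $i_1<\dots<i_l$. For simple words $\mathbf{u},\mathbf{v}$, $\mathbf{u}_{\mathbf{v}}$ is the subword of $\mathbf{u}$ formed by letters occurring in both. $\mathsf{Shuf}(m,n)$ is the set of simple words $\mathbf{u}$ over $X\cup Y$ with $\mathbf{u}_{\mathbf{x}}$ a subword of $\mathbf{x}$ and $\mathbf{u}_{\mathbf{y}}$ a subword of $\mathbf{y}$. $\mathsf{Inv}(\mathbf{u})=\{(x_s,y_t): y_t\text{ occurs before }x_s\text{ in }\mathbf{u}\}$. For $\mathbf{u}=u_1\cdots u_k$, $\mathbf{u}_{\hat\imath}$ is $\mathbf{u}$ with $u_i$ deleted. Indels: $\mathbf{u}\to\mathbf{u}_{\hat\imath}$ if $u_i\in X$, and $\mathbf{u}_{\hat\imath}\to\mathbf{u}$ if $u_i\in Y$. Transpositions: $\mathbf{u}\Rightarrow\mathbf{u}'$ where $u_i\in X$, $u_{i+1}\in Y$ and $\mathbf{u}'$ is $\mathbf{u}$ with $u_i,u_{i+1}$ swapped. The bubble order $\leq_{\mathsf{bub}}$ is the reflexive transitive closure of indels and transpositions; $\lessdot_{\mathsf{bub}}$ denotes its cover relation. -}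

module Defs where

open import Data.Nat using (ℕ)
open import Data.Fin using (Fin)
open import Data.Sum using (_⊎_; inj₁; inj₂; isInj₁; isInj₂)
open import Data.List using (List; []; _∷_; _++_; mapMaybe; allFin)
open import Data.List.Relation.Unary.Unique.Propositional using (Unique)
open import Data.List.Relation.Binary.Sublist.Propositional using (_⊆_)
open import Data.Product using (_×_; ∃; ∃-syntax; _,_)
open import Relation.Binary.PropositionalEquality using (_≡_)
open import Relation.Binary.Construct.Closure.ReflexiveTransitive using (Star)
open import Relation.Nullary using (¬_)

-- Letters: X = {x_1..x_m} is Fin m (via inj₁), Y = {y_1..y_n} is Fin n (via inj₂).
Letter : ℕ → ℕ → Set
Letter m n = Fin m ⊎ Fin n

Word : ℕ → ℕ → Set
Word m n = List (Letter m n)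

xPart : ∀ {m n} → Word m n → List (Fin m)
xPart = mapMaybe isInj₁

yPart : ∀ {m n} → Word m n → List (Fin n)
yPart = mapMaybe isInj₂

Shuf : ∀ m n → Word m n → Set
Shuf m n u = Unique u × (xPart u ⊆ allFin m) × (yPart u ⊆ allFin n)

Inv : ∀ {m n} → Word m n → Fin m → Fin n → Set
Inv u s t = ∃[ p ] ∃[ q ] ∃[ r ] (u ≡ p ++ inj₂ t ∷ q ++ inj₁ s ∷ r)

data Move {m n : ℕ} : Word m n → Word m n → Set where
  delX  : ∀ p (a : Fin m) q → Move (p ++ inj₁ a ∷ q) (p ++ q)
  insY  : ∀ p (b : Fin n) q → Move (p ++ q) (p ++ inj₂ b ∷ q)
  trans : ∀ p (a : Fin m) (b : Fin n) q →
          Move (p ++ inj₁ a ∷ inj₂ b ∷ q) (p ++ inj₂ b ∷ inj₁ a ∷ q)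

Step : ∀ m n → Word m n → Word m n → Set
Step m n u v = Shuf m n u × Shuf m n v × Move u v

_≤bub_ : ∀ {m n} → Word m n → Word m n → Set
_≤bub_ {m} {n} = Star (Step m n)

_⋖bub_ : ∀ {m n} → Word m n → Word m n → Set
u ⋖bub v = (u ≤bub v) × ¬ (u ≡ v) ×
           (∀ w → u ≤bub w → w ≤bub v → (w ≡ u) ⊎ (w ≡ v))

-- A simple word is determined by its set of letters together with the relative order of each
-- pair of its letters. Going up the bubble order, X-letters can only disappear, Y-letters can
-- only appear, and every relative order persists except that an X-letter may be overtaken by a
-- Y-letter. Hence any w with u ≤ w ≤ v, where u → v is a single move, is pinned down by the one
-- piece of data that the move changes, so the move is a cover unless that data can be changed
-- in two smaller moves: deleting x is a cover iff x is followed by an X-letter or by nothing,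
-- inserting y is a cover iff y is followed by a Y-letter or by nothing, and every transposition
-- is a cover. Conversely every cover is a single move.
-- (1) A lower cover of v containing x comes from deleting x, and x must then be followed by an
-- X-letter or nothing; since the X-letters of a shuffle word are increasing, this fixes the
-- position of x. (2) A lower cover of v that loses y or undoes the inversion of y with its
-- successor comes from deleting y or from transposing y with its successor; which of the two is
-- a cover depends on whether that successor is an X-letter.
module Submission where

open import Defs
open import Data.Nat using (ℕ)
open import Data.Nat.Properties using (1+n≢n)
open import Data.Fin using (Fin; _<_; _<?_; _≟_)
open import Data.Fin.Properties using (<-asym)
open import Data.Sum using (_⊎_; inj₁; inj₂; isInj₁; isInj₂; map₂)
open import Data.Sum.Properties using (≡-dec; inj₁-injective; inj₂-injective)
open import Data.Maybe using (Maybe; just; nothing)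
open import Data.List using (List; []; _∷_; [_]; _++_; length; mapMaybe; allFin)
open import Data.List.Properties using (∷-injective; ++-cancelˡ; mapMaybe-++)
open import Data.List.Membership.Propositional using (_∈_; _∉_)
open import Data.List.Membership.Propositional.Properties
  using (∈-++⁺ʳ; ∈-insert; ∈-∃++; ∈-allFin)
import Data.List.Membership.DecPropositional as DecMembership
open import Data.List.Relation.Unary.Any using (here; there)
open import Data.List.Relation.Unary.All as All using (All; []; _∷_)
open import Data.List.Relation.Unary.All.Properties using (¬Any⇒All¬)
open import Data.List.Relation.Unary.AllPairs using (AllPairs; []; _∷_)
open import Data.List.Relation.Unary.AllPairs.Properties using (tabulate⁺-<)
open import Data.List.Relation.Unary.Unique.Propositional using (Unique)
open import Data.List.Relation.Unary.Unique.Propositional.Properties using (Unique[x∷xs]⇒x∉xs)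
open import Data.List.Relation.Binary.Sublist.Propositional
  using (_⊆_; _∷_; _∷ʳ_; lookup; ⊆-refl; ⊆-trans)
open import Data.List.Relation.Binary.Sublist.Propositional.Properties using (++⁺)
open import Data.List.Relation.Binary.Permutation.Propositional
  using (_↭_; ↭⇒↭ₛ; ↭-sym; ↭-refl; swap)
open import Data.List.Relation.Binary.Permutation.Propositional.Properties
  using (shift; ∈-resp-↭; ++⁺ˡ)
import Data.List.Relation.Binary.Permutation.Setoid.Properties as Permutationₛ
open import Data.Product using (_×_; ∃-syntax; ∃!; _,_; proj₁; proj₂)
open import Data.Empty using (⊥; ⊥-elim)
open import Data.Unit using (⊤; tt)
open import Function using (_∘_)
open import Relation.Binary.PropositionalEquality
  using (_≡_; _≢_; refl; sym; cong; subst; setoid) renaming (trans to ≡-trans)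
open import Relation.Binary.Construct.Closure.ReflexiveTransitive using (ε; _◅_)
open import Relation.Nullary using (¬_; yes; no)

-- Relative order of letters in a list

data Before {A : Set} : List A → A → A → Set where
  first : ∀ {a b xs} → b ∈ xs → Before (a ∷ xs) a b
  later : ∀ {a b c xs} → Before xs a b → Before (c ∷ xs) a b

module _ {A : Set} where

  private variable
    a b c d e f : A
    xs ys p q q′ : List A

  Before⇒∈ˡ : Before xs a b → a ∈ xs
  Before⇒∈ˡ (first _)  = here refl
  Before⇒∈ˡ (later ab) = there (Before⇒∈ˡ ab)

  Before⇒∈ʳ : Before xs a b → b ∈ xs
  Before⇒∈ʳ (first b∈) = there b∈
  Before⇒∈ʳ (later ab) = there (Before⇒∈ʳ ab)

  Before-++⁺ʳ : ∀ p → Before xs a b → Before (p ++ xs) a b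
  Before-++⁺ʳ []      ab = ab
  Before-++⁺ʳ (c ∷ p) ab = later (Before-++⁺ʳ p ab)

  Before-⊆ : Before xs a b → xs ⊆ ys → Before ys a b
  Before-⊆ ab          (c ∷ʳ σ)   = later (Before-⊆ ab σ)
  Before-⊆ (first b∈)  (refl ∷ σ) = first (lookup σ b∈)
  Before-⊆ (later ab)  (refl ∷ σ) = later (Before-⊆ ab σ)

  Before-total : a ∈ xs → b ∈ xs → a ≢ b → Before xs a b ⊎ Before xs b a
  Before-total (here refl) (here refl) a≢b = ⊥-elim (a≢b refl)
  Before-total (here refl) (there b∈)  _   = inj₁ (first b∈)
  Before-total (there a∈)  (here refl) _   = inj₂ (first a∈)
  Before-total (there a∈)  (there b∈)  a≢b with Before-total a∈ b∈ a≢b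
  ... | inj₁ ab = inj₁ (later ab)
  ... | inj₂ ba = inj₂ (later ba)

  Before⇒split : Before xs a b → ∃[ p ] ∃[ q ] ∃[ r ] (xs ≡ p ++ a ∷ q ++ b ∷ r)
  Before⇒split (first b∈) with ∈-∃++ b∈
  ... | q , r , refl = [] , q , r , refl
  Before⇒split {xs = c ∷ _} (later ab) with Before⇒split ab
  ... | p , q , r , refl = c ∷ p , q , r , refl

  split⇒Before : ∃[ p ] ∃[ q ] ∃[ r ] (xs ≡ p ++ a ∷ q ++ b ∷ r) → Before xs a b
  split⇒Before (p , q , r , refl) = Before-++⁺ʳ p (first (∈-insert q))

  insertion-⊆ : ∀ p → p ++ q ⊆ p ++ e ∷ q
  insertion-⊆ p = ++⁺ (⊆-refl {x = p}) (_ ∷ʳ ⊆-refl)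

  ∈-insertion : ∀ p → b ∈ p ++ q → b ∈ p ++ e ∷ q
  ∈-insertion p = lookup (insertion-⊆ p)

  ∈-deletion : ∀ p → b ∈ p ++ e ∷ q → b ≢ e → b ∈ p ++ q
  ∈-deletion p b∈ b≢e with ∈-resp-↭ (shift _ p _) b∈
  ... | here b≡e = ⊥-elim (b≢e b≡e)
  ... | there b∈′ = b∈′

  ∈-swap : ∀ p → b ∈ p ++ e ∷ f ∷ q → b ∈ p ++ f ∷ e ∷ q
  ∈-swap p = ∈-resp-↭ (++⁺ˡ p (swap _ _ ↭-refl))

  Before-insertion : ∀ p → Before (p ++ q) a b → Before (p ++ e ∷ q) a b
  Before-insertion p ab = Before-⊆ ab (insertion-⊆ p)

  Before-deletion : ∀ p → Before (p ++ e ∷ q) a b → a ≢ e → b ≢ e → Before (p ++ q) a b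
  Before-deletion []      (first _)  a≢e _   = ⊥-elim (a≢e refl)
  Before-deletion []      (later ab) _   _   = ab
  Before-deletion (c ∷ p) (first b∈) _   b≢e = first (∈-deletion p b∈ b≢e)
  Before-deletion (c ∷ p) (later ab) a≢e b≢e = later (Before-deletion p ab a≢e b≢e)

  Before-swap : ∀ p → Before (p ++ e ∷ f ∷ q) a b →
                (a ≡ e × b ≡ f) ⊎ Before (p ++ f ∷ e ∷ q) a b
  Before-swap []      (first (here refl))  = inj₁ (refl , refl)
  Before-swap []      (first (there b∈))   = inj₂ (later (first b∈))
  Before-swap []      (later (first b∈))   = inj₂ (first (there b∈))
  Before-swap []      (later (later ab))   = inj₂ (later (later ab))
  Before-swap (c ∷ p) (first b∈)           = inj₂ (first (∈-swap p b∈))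
  Before-swap (c ∷ p) (later ab)           = map₂ later (Before-swap p ab)

  Unique-resp-↭ : xs ↭ ys → Unique xs → Unique ys
  Unique-resp-↭ σ = Permutationₛ.Unique-resp-↭ (setoid A) (↭⇒↭ₛ σ)

  Unique-deletion : ∀ p → Unique (p ++ e ∷ q) → Unique (p ++ q)
  Unique-deletion p u with Unique-resp-↭ (shift _ p _) u
  ... | _ ∷ u′ = u′

  Unique-deletion⇒∉ : ∀ p → Unique (p ++ e ∷ q) → e ∉ p ++ q
  Unique-deletion⇒∉ p u = Unique[x∷xs]⇒x∉xs (Unique-resp-↭ (shift _ p _) u)

  Unique-insertion : ∀ p → Unique (p ++ q) → e ∉ p ++ q → Unique (p ++ e ∷ q)
  Unique-insertion p u e∉ = Unique-resp-↭ (↭-sym (shift _ p _)) (¬Any⇒All¬ _ e∉ ∷ u)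

  Unique-swap : ∀ p → Unique (p ++ e ∷ f ∷ q) → Unique (p ++ f ∷ e ∷ q)
  Unique-swap p = Unique-resp-↭ (++⁺ˡ p (swap _ _ ↭-refl))

  Before-asym : Unique xs → Before xs a b → ¬ Before xs b a
  Before-asym u        (first _)  (first a∈) = Unique[x∷xs]⇒x∉xs u a∈
  Before-asym u        (first _)  (later ba) = Unique[x∷xs]⇒x∉xs u (Before⇒∈ʳ ba)
  Before-asym u        (later ab) (first _)  = Unique[x∷xs]⇒x∉xs u (Before⇒∈ʳ ab)
  Before-asym (_ ∷ u)  (later ab) (later ba) = Before-asym u ab ba

  Before-trans : Unique xs → Before xs a b → Before xs b c → Before xs a c
  Before-trans u       (first b∈) (first _)  = ⊥-elim (Unique[x∷xs]⇒x∉xs u b∈)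
  Before-trans u       (first _)  (later bc) = first (Before⇒∈ʳ bc)
  Before-trans u       (later ab) (first _)  = ⊥-elim (Unique[x∷xs]⇒x∉xs u (Before⇒∈ʳ ab))
  Before-trans (_ ∷ u) (later ab) (later bc) = later (Before-trans u ab bc)

  Before-after : ∀ p → Unique (p ++ e ∷ q) → Before (p ++ e ∷ q) e d → d ∈ q
  Before-after []      u       (first d∈) = d∈
  Before-after []      u       (later ed) = ⊥-elim (Unique[x∷xs]⇒x∉xs u (Before⇒∈ˡ ed))
  Before-after (c ∷ p) u       (first _)  = ⊥-elim (Unique[x∷xs]⇒x∉xs u (∈-insert p))
  Before-after (c ∷ p) (_ ∷ u) (later ed) = Before-after p u ed

  Unique-split : ∀ p p′ → Unique (p ++ e ∷ q) → p ++ e ∷ q ≡ p′ ++ e ∷ q′ →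
                 p ≡ p′ × q ≡ q′
  Unique-split []      []       _       eq = refl , proj₂ (∷-injective eq)
  Unique-split []      (c ∷ p′) u       eq with ∷-injective eq
  ... | refl , eq′ = ⊥-elim (Unique[x∷xs]⇒x∉xs u (subst (_ ∈_) (sym eq′) (∈-insert p′)))
  Unique-split (c ∷ p) []       u       eq with ∷-injective eq
  ... | refl , _ = ⊥-elim (Unique[x∷xs]⇒x∉xs u (∈-insert p))
  Unique-split (c ∷ p) (c′ ∷ p′) (_ ∷ u) eq with ∷-injective eq
  ... | refl , eq′ with Unique-split p p′ u eq′
  ... | refl , q≡q′ = refl , q≡q′

  Unique-heads-≡ : Unique (b ∷ ys) → a ∈ b ∷ ys → b ∈ a ∷ xs →
                   (Before (a ∷ xs) a b → Before (b ∷ ys) a b) → a ≡ b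
  Unique-heads-≡ _ (here a≡b) _           _ = a≡b
  Unique-heads-≡ _ (there _)  (here b≡a)  _ = sym b≡a
  Unique-heads-≡ u (there _)  (there b∈) ≺ with ≺ (first b∈)
  ... | first _  = refl
  ... | later ab = ⊥-elim (Unique[x∷xs]⇒x∉xs u (Before⇒∈ʳ ab))

  Unique-≡ : Unique xs → Unique ys →
             (∀ {a} → a ∈ xs → a ∈ ys) → (∀ {a} → a ∈ ys → a ∈ xs) →
             (∀ {a b} → Before xs a b → Before ys a b) → xs ≡ ys
  Unique-≡ {[]}     {[]}     _  _  _ _ _ = refl
  Unique-≡ {[]}     {b ∷ _}  _  _  _ ⊇ _ with ⊇ (here refl)
  ... | ()
  Unique-≡ {a ∷ _}  {[]}     _  _  ⊆ _ _ with ⊆ (here refl)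
  ... | ()
  Unique-≡ {a ∷ xs} {b ∷ ys} u₁ u₂ ⊆ ⊇ ≺
    with Unique-heads-≡ u₂ (⊆ (here refl)) (⊇ (here refl)) ≺
  ... | refl = cong (a ∷_) (Unique-≡ (tail u₁) (tail u₂) (inTail u₁ ⊆) (inTail u₂ ⊇) ≺′)
    where
    tail : ∀ {zs} → Unique (a ∷ zs) → Unique zs
    tail (_ ∷ u) = u
    inTail : ∀ {zs zs′} → Unique (a ∷ zs) → (∀ {c} → c ∈ a ∷ zs → c ∈ a ∷ zs′) →
             ∀ {c} → c ∈ zs → c ∈ zs′
    inTail u sub c∈ with sub (there c∈)
    ... | here refl = ⊥-elim (Unique[x∷xs]⇒x∉xs u c∈)
    ... | there c∈′ = c∈′
    ≺′ : ∀ {c d} → Before xs c d → Before ys c d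
    ≺′ cd with ≺ (later cd)
    ... | first _   = ⊥-elim (Unique[x∷xs]⇒x∉xs u₁ (Before⇒∈ˡ cd))
    ... | later cd′ = cd′

  AllPairs-Before : ∀ {R : A → A → Set} → AllPairs R xs → Before xs a b → R a b
  AllPairs-Before (r ∷ _) (first b∈) = All.lookup r b∈
  AllPairs-Before (_ ∷ r) (later ab) = AllPairs-Before r ab

-- Shuffle words

mapMaybe-deletion-⊆ : ∀ {A B : Set} (g : A → Maybe B) p {e q} →
                      mapMaybe g (p ++ q) ⊆ mapMaybe g (p ++ e ∷ q)
mapMaybe-deletion-⊆ g [] {e} with g e
... | just _  = _ ∷ʳ ⊆-refl
... | nothing = ⊆-refl
mapMaybe-deletion-⊆ g (c ∷ p) with g c
... | just _  = refl ∷ mapMaybe-deletion-⊆ g p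
... | nothing = mapMaybe-deletion-⊆ g p

mapMaybe-deletion-≢ : ∀ {A B : Set} (g : A → Maybe B) p {e b q} → g e ≡ just b →
                      mapMaybe g (p ++ e ∷ q) ≢ mapMaybe g (p ++ q)
mapMaybe-deletion-≢ g [] {e} ge with g e | ge
... | just _ | refl = 1+n≢n ∘ cong length
mapMaybe-deletion-≢ g (c ∷ p) ge with g c
... | just _  = mapMaybe-deletion-≢ g p ge ∘ proj₂ ∘ ∷-injective
... | nothing = mapMaybe-deletion-≢ g p ge

allFin-sorted : ∀ k → AllPairs _<_ (allFin k)
allFin-sorted k = tabulate⁺-< (λ i<j → i<j)

insertFin : ∀ {k} → Fin k → List (Fin k) → List (Fin k)
insertFin i []       = [ i ]
insertFin i (j ∷ js) with i <? j
... | yes _ = i ∷ j ∷ js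
... | no  _ = j ∷ insertFin i js

insertFin-head : ∀ {k} {i : Fin k} {js} → All (i <_) js → insertFin i js ≡ i ∷ js
insertFin-head [] = refl
insertFin-head {i = i} {j ∷ _} (i<j ∷ _) with i <? j
... | yes _   = refl
... | no i≮j = ⊥-elim (i≮j i<j)

insertFin-⊆ : ∀ {k} {i : Fin k} {js ks} → AllPairs _<_ ks → i ∈ ks → i ∉ js → js ⊆ ks →
              insertFin i js ⊆ ks
insertFin-⊆ (i< ∷ _) (here refl) _ (_ ∷ʳ σ) =
  subst (_⊆ _) (sym (insertFin-head (All.tabulate (All.lookup i< ∘ lookup σ)))) (refl ∷ σ)
insertFin-⊆ _ (here refl) i∉ (refl ∷ _) = ⊥-elim (i∉ (here refl))
insertFin-⊆ (_ ∷ sorted) (there i∈) i∉ (_ ∷ʳ σ) = _ ∷ʳ insertFin-⊆ sorted i∈ i∉ σ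
insertFin-⊆ {i = i} (j< ∷ sorted) (there i∈) i∉ (_∷_ {x = j} refl σ) with i <? j
... | yes i<j = ⊥-elim (<-asym i<j (All.lookup j< i∈))
... | no _    = refl ∷ insertFin-⊆ sorted i∈ (i∉ ∘ there) σ

module _ {m n : ℕ} where

  open DecMembership (≡-dec (_≟_ {m}) (_≟_ {n})) using (_∈?_)

  private variable
    u v w : Word m n
    a b : Letter m n
    s : Fin m
    t : Fin n

  data HeadIsX : Word m n → Set where
    empty : HeadIsX []
    cons  : ∀ s w → HeadIsX (inj₁ s ∷ w)

  data HeadIsY : Word m n → Set where
    empty : HeadIsY []
    cons  : ∀ t w → HeadIsY (inj₂ t ∷ w)

  ∈-xPart⁻ : ∀ {w : Word m n} {s} → s ∈ xPart w → inj₁ s ∈ w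
  ∈-xPart⁻ {inj₁ _ ∷ _} (here refl) = here refl
  ∈-xPart⁻ {inj₁ _ ∷ _} (there s∈) = there (∈-xPart⁻ s∈)
  ∈-xPart⁻ {inj₂ _ ∷ _} s∈         = there (∈-xPart⁻ s∈)

  ∈-xPart⁺ : ∀ {w : Word m n} {s} → inj₁ s ∈ w → s ∈ xPart w
  ∈-xPart⁺ {inj₁ _ ∷ _} (here refl) = here refl
  ∈-xPart⁺ {inj₁ _ ∷ _} (there s∈) = there (∈-xPart⁺ s∈)
  ∈-xPart⁺ {inj₂ _ ∷ _} (there s∈) = ∈-xPart⁺ s∈

  Before-xPart : ∀ {w : Word m n} {s s′} → Before w (inj₁ s) (inj₁ s′) → Before (xPart w) s s′
  Before-xPart {inj₁ _ ∷ _} (first s′∈) = first (∈-xPart⁺ s′∈)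
  Before-xPart {inj₁ _ ∷ _} (later ss′) = later (Before-xPart ss′)
  Before-xPart {inj₂ _ ∷ _} (later ss′) = Before-xPart ss′

  XSorted : Word m n → Set
  XSorted w = ∀ {s s′} → Before w (inj₁ s) (inj₁ s′) → s < s′

  Shuf⇒XSorted : Shuf m n w → XSorted w
  Shuf⇒XSorted (_ , x⊆ , _) ss′ =
    AllPairs-Before (allFin-sorted m) (Before-⊆ (Before-xPart ss′) x⊆)

  xPart-swap : ∀ p {q} →
               xPart (p ++ inj₁ s ∷ inj₂ t ∷ q) ≡ xPart (p ++ inj₂ t ∷ inj₁ s ∷ q)
  xPart-swap p = ≡-trans (mapMaybe-++ isInj₁ p _) (sym (mapMaybe-++ isInj₁ p _))

  yPart-swap : ∀ p {q} →
               yPart (p ++ inj₁ s ∷ inj₂ t ∷ q) ≡ yPart (p ++ inj₂ t ∷ inj₁ s ∷ q)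
  yPart-swap p = ≡-trans (mapMaybe-++ isInj₂ p _) (sym (mapMaybe-++ isInj₂ p _))

  Shuf-swapˣʸ : ∀ p {q} → Shuf m n (p ++ inj₁ s ∷ inj₂ t ∷ q) →
                Shuf m n (p ++ inj₂ t ∷ inj₁ s ∷ q)
  Shuf-swapˣʸ p (u , x⊆ , y⊆) =
    Unique-swap p u ,
    subst (_⊆ allFin m) (xPart-swap p) x⊆ ,
    subst (_⊆ allFin n) (yPart-swap p) y⊆

  Shuf-swapʸˣ : ∀ p {q} → Shuf m n (p ++ inj₂ t ∷ inj₁ s ∷ q) →
                Shuf m n (p ++ inj₁ s ∷ inj₂ t ∷ q)
  Shuf-swapʸˣ p (u , x⊆ , y⊆) =
    Unique-swap p u ,
    subst (_⊆ allFin m) (sym (xPart-swap p)) x⊆ ,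
    subst (_⊆ allFin n) (sym (yPart-swap p)) y⊆

  Shuf-deletion : ∀ p {e q} → Shuf m n (p ++ e ∷ q) → Shuf m n (p ++ q)
  Shuf-deletion p (u , x⊆ , y⊆) =
    Unique-deletion p u ,
    ⊆-trans (mapMaybe-deletion-⊆ isInj₁ p) x⊆ ,
    ⊆-trans (mapMaybe-deletion-⊆ isInj₂ p) y⊆

  insertX-split : ∀ x (w : Word m n) →
                  ∃[ p ] ∃[ q ] (w ≡ p ++ q × HeadIsX q ×
                                 xPart (p ++ inj₁ x ∷ q) ≡ insertFin x (xPart w))
  insertX-split x [] = [] , [] , refl , empty , refl
  insertX-split x (inj₂ t ∷ w) with insertX-split x w
  ... | p , q , refl , hq , xe = inj₂ t ∷ p , q , refl , hq , xe
  insertX-split x (inj₁ s ∷ w) with x <? s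
  ... | yes _ = [] , inj₁ s ∷ w , refl , cons s w , refl
  ... | no _ with insertX-split x w
  ...   | p , q , refl , hq , xe = inj₁ s ∷ p , q , refl , hq , cong (s ∷_) xe

  insertion-point : ∀ x → Shuf m n v → inj₁ x ∉ v →
                    ∃[ p ] ∃[ q ] (v ≡ p ++ q × HeadIsX q × Shuf m n (p ++ inj₁ x ∷ q))
  insertion-point {v} x (uv , x⊆ , y⊆) x∉ with insertX-split x v
  ... | p , q , refl , hq , xe = p , q , refl , hq , Unique-insertion p uv x∉ , x⊆′ , y⊆′
    where
    x⊆′ : xPart (p ++ inj₁ x ∷ q) ⊆ allFin m
    x⊆′ = subst (_⊆ allFin m) (sym xe)
                (insertFin-⊆ (allFin-sorted m) (∈-allFin x) (x∉ ∘ ∈-xPart⁻) x⊆)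
    y⊆′ : yPart (p ++ inj₁ x ∷ q) ⊆ allFin n
    y⊆′ = subst (_⊆ allFin n) (≡-trans (mapMaybe-++ isInj₂ p q) (sym (mapMaybe-++ isInj₂ p _)))
                y⊆

  -- Moves and the bubble order

  XY : Letter m n → Letter m n → Set
  XY (inj₁ _) (inj₂ _) = ⊤
  XY _        _        = ⊥

  Move-∷ : ∀ c → Move u v → Move (c ∷ u) (c ∷ v)
  Move-∷ c (delX p a q)    = delX (c ∷ p) a q
  Move-∷ c (insY p b q)    = insY (c ∷ p) b q
  Move-∷ c (trans p a b q) = trans (c ∷ p) a b q

  Move-++ : ∀ r → Move u v → Move (r ++ u) (r ++ v)
  Move-++ []      mv = mv
  Move-++ (c ∷ r) mv = Move-∷ c (Move-++ r mv)

  Move-irreflexive : Move u v → u ≢ v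
  Move-irreflexive (delX p _ _) eq with ++-cancelˡ p _ _ eq
  ... | ()
  Move-irreflexive (insY p _ _) eq with ++-cancelˡ p _ _ eq
  ... | ()
  Move-irreflexive (trans p _ _ _) eq with ++-cancelˡ p _ _ eq
  ... | ()

  Move-∈ˣ : Move u v → inj₁ s ∈ v → inj₁ s ∈ u
  Move-∈ˣ (delX p _ _)    s∈ = ∈-insertion p s∈
  Move-∈ˣ (insY p _ _)    s∈ = ∈-deletion p s∈ λ ()
  Move-∈ˣ (trans p _ _ _) s∈ = ∈-swap p s∈

  Move-∈ʸ : Move u v → inj₂ t ∈ u → inj₂ t ∈ v
  Move-∈ʸ (delX p _ _)    t∈ = ∈-deletion p t∈ λ ()
  Move-∈ʸ (insY p _ _)    t∈ = ∈-insertion p t∈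
  Move-∈ʸ (trans p _ _ _) t∈ = ∈-swap p t∈

  Move-Before : Unique u → Move u v → Before u a b → a ∈ v → b ∈ v → ¬ XY a b → Before v a b
  Move-Before uu (delX p _ _) ab a∈ b∈ _ =
    Before-deletion p ab (λ { refl → Unique-deletion⇒∉ p uu a∈ })
                         (λ { refl → Unique-deletion⇒∉ p uu b∈ })
  Move-Before _ (insY p _ _) ab _ _ _ = Before-insertion p ab
  Move-Before _ (trans p _ _ _) ab _ _ ¬xy with Before-swap p ab
  ... | inj₁ (refl , refl) = ⊥-elim (¬xy tt)
  ... | inj₂ ab′           = ab′

  ≤bub-Shuf : u ≤bub v → Shuf m n u → Shuf m n v
  ≤bub-Shuf ε                  su = su
  ≤bub-Shuf ((_ , sw , _) ◅ wv) _  = ≤bub-Shuf wv sw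

  ≤bub-∈ˣ : u ≤bub v → inj₁ s ∈ v → inj₁ s ∈ u
  ≤bub-∈ˣ ε                  s∈ = s∈
  ≤bub-∈ˣ ((_ , _ , mv) ◅ wv) s∈ = Move-∈ˣ mv (≤bub-∈ˣ wv s∈)

  ≤bub-∈ʸ : u ≤bub v → inj₂ t ∈ u → inj₂ t ∈ v
  ≤bub-∈ʸ ε                  t∈ = t∈
  ≤bub-∈ʸ ((_ , _ , mv) ◅ wv) t∈ = ≤bub-∈ʸ wv (Move-∈ʸ mv t∈)

  ∈-between : u ≤bub w → w ≤bub v → a ∈ u → a ∈ v → a ∈ w
  ∈-between {a = inj₁ _} _  wv _   a∈v = ≤bub-∈ˣ wv a∈v
  ∈-between {a = inj₂ _} uw _  a∈u _   = ≤bub-∈ʸ uw a∈u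

  ≤bub-Before : u ≤bub v → Before u a b → a ∈ v → b ∈ v → ¬ XY a b → Before v a b
  ≤bub-Before ε ab _ _ _ = ab
  ≤bub-Before {u = u} {v = v} {a = a} {b = b} (_◅_ {j = w} st@(su , _ , mv) wv) ab a∈ b∈ ¬xy =
    ≤bub-Before wv ab′ a∈ b∈ ¬xy
    where
    mid : ∀ {c} → c ∈ u → c ∈ v → c ∈ w
    mid = ∈-between (st ◅ ε) wv
    ab′ : Before w a b
    ab′ = Move-Before (proj₁ su) mv ab (mid (Before⇒∈ˡ ab) a∈) (mid (Before⇒∈ʳ ab) b∈) ¬xy

  -- The only order that can change going up is an X-letter overtaken by a Y-letter.
  ≤bub-≡ : Shuf m n u → u ≤bub v →
           (∀ {s} → inj₁ s ∈ u → inj₁ s ∈ v) →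
           (∀ {t} → inj₂ t ∈ v → inj₂ t ∈ u) →
           (∀ {s t} → Before u (inj₁ s) (inj₂ t) → ¬ Before v (inj₂ t) (inj₁ s)) → u ≡ v
  ≤bub-≡ {u} {v} su uv keepX keepY noInversion =
    Unique-≡ (proj₁ su) (proj₁ (≤bub-Shuf uv su)) u⊆v v⊆u order
    where
    u⊆v : a ∈ u → a ∈ v
    u⊆v {inj₁ _} = keepX
    u⊆v {inj₂ _} = ≤bub-∈ʸ uv
    v⊆u : a ∈ v → a ∈ u
    v⊆u {inj₁ _} = ≤bub-∈ˣ uv
    v⊆u {inj₂ _} = keepY
    transport : ¬ XY a b → Before u a b → Before v a b
    transport ¬xy ab = ≤bub-Before uv ab (u⊆v (Before⇒∈ˡ ab)) (u⊆v (Before⇒∈ʳ ab)) ¬xy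
    order : Before u a b → Before v a b
    order {inj₁ _} {inj₂ _} ab
      with Before-total (u⊆v (Before⇒∈ˡ ab)) (u⊆v (Before⇒∈ʳ ab)) (λ ())
    ... | inj₁ ab′ = ab′
    ... | inj₂ ba  = ⊥-elim (noInversion ab ba)
    order {inj₁ _} {inj₁ _} = transport λ ()
    order {inj₂ _}          = transport λ ()

  -- Covers given by single moves

  NothingBetween : Word m n → Word m n → Set
  NothingBetween u v = ∀ w → u ≤bub w → w ≤bub v → (w ≡ u) ⊎ (w ≡ v)

  Step⇒⋖bub : Step m n u v → NothingBetween u v → u ⋖bub v
  Step⇒⋖bub st between = st ◅ ε , Move-irreflexive (proj₂ (proj₂ st)) , between

  ⋖bub⇒Step : u ⋖bub v → Step m n u v
  ⋖bub⇒Step (ε , u≢v , _) = ⊥-elim (u≢v refl)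
  ⋖bub⇒Step (_◅_ {j = w} st wv , _ , between) with between w (st ◅ ε) wv
  ... | inj₁ refl = ⊥-elim (Move-irreflexive (proj₂ (proj₂ st)) refl)
  ... | inj₂ refl = st

  -- A Y-letter after x in the bottom word also follows the X-letter after x; if it preceded x
  -- in w, it would precede that X-letter in w, hence in the top word, hence in the bottom word.
  deletion-blocked : ∀ p q x {w t} → HeadIsX q → Shuf m n (p ++ inj₁ x ∷ q) →
                     (p ++ inj₁ x ∷ q) ≤bub w → w ≤bub (p ++ q) → inj₁ x ∈ w →
                     Before (p ++ inj₁ x ∷ q) (inj₁ x) (inj₂ t) → ¬ Before w (inj₂ t) (inj₁ x)
  deletion-blocked p q x {w} hq su uw wv x∈w xt tx with hq | Before-after p (proj₁ su) xt
  ... | empty      | ()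
  ... | cons _ _   | here ()
  ... | cons s′ q′ | there t∈q′ =
    Before-asym (proj₁ su) (Before-++⁺ʳ p (later (first t∈q′))) ts′
    where
    xs′ : Before w (inj₁ x) (inj₁ s′)
    xs′ = ≤bub-Before uw (Before-++⁺ʳ p (first (here refl))) x∈w
                     (≤bub-∈ˣ wv (∈-++⁺ʳ p (here refl))) λ ()
    ts′ : Before (p ++ inj₁ x ∷ inj₁ s′ ∷ q′) (inj₂ _) (inj₁ s′)
    ts′ = Before-insertion p (≤bub-Before wv (Before-trans (proj₁ (≤bub-Shuf uw su)) tx xs′)
                                (≤bub-∈ʸ wv (Before⇒∈ˡ tx)) (∈-++⁺ʳ p (here refl)) λ ())

  -- An X-letter after y in the top word also follows the Y-letter t after y, already in the
  -- bottom word and hence in w; if it preceded y in w, then t would precede y in the top word.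
  insertion-blocked : ∀ p q y {w s} → HeadIsY q → Shuf m n (p ++ inj₂ y ∷ q) →
                      (p ++ q) ≤bub w → w ≤bub (p ++ inj₂ y ∷ q) →
                      Before w (inj₁ s) (inj₂ y) → ¬ Before (p ++ inj₂ y ∷ q) (inj₂ y) (inj₁ s)
  insertion-blocked p q y {w} hq sv uw wv sy ys with hq | Before-after p (proj₁ sv) ys
  ... | empty     | ()
  ... | cons _ _  | here ()
  ... | cons t q′ | there s∈q′ =
    Before-asym (proj₁ sv) (Before-++⁺ʳ p (first (here refl))) ty
    where
    t≢y : inj₂ t ≢ inj₂ y
    t≢y refl = Unique-deletion⇒∉ p (proj₁ sv) (∈-++⁺ʳ p (here refl))
    ts : Before w (inj₂ t) (inj₁ _)
    ts = ≤bub-Before uw (Before-deletion p (Before-++⁺ʳ p (later (first s∈q′))) t≢y λ ())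
                     (≤bub-∈ʸ uw (∈-++⁺ʳ p (here refl))) (Before⇒∈ˡ sy) λ ()
    ty : Before (p ++ inj₂ y ∷ inj₂ t ∷ q′) (inj₂ t) (inj₂ y)
    ty = ≤bub-Before wv (Before-trans (proj₁ (≤bub-Shuf uw (Shuf-deletion p sv))) ts sy)
                     (∈-++⁺ʳ p (there (here refl))) (∈-++⁺ʳ p (here refl)) λ ()

  delX-⋖bub : ∀ p q x → HeadIsX q → Shuf m n (p ++ inj₁ x ∷ q) → Shuf m n (p ++ q) →
              (p ++ inj₁ x ∷ q) ⋖bub (p ++ q)
  delX-⋖bub p q x hq su sv = Step⇒⋖bub (su , sv , delX p x q) between
    where
    bottom top : Word m n
    bottom = p ++ inj₁ x ∷ q
    top = p ++ q
    between : NothingBetween bottom top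
    between w uw wv with inj₁ x ∈? w
    ... | yes x∈w = inj₁ (sym (≤bub-≡ su uw keepX keepY noInversion))
      where
      keepX : ∀ {s} → inj₁ s ∈ bottom → inj₁ s ∈ w
      keepX {s} s∈ with s ≟ x
      ... | yes refl = x∈w
      ... | no s≢x   = ≤bub-∈ˣ wv (∈-deletion p s∈ (s≢x ∘ inj₁-injective))
      keepY : ∀ {t} → inj₂ t ∈ w → inj₂ t ∈ bottom
      keepY = ∈-insertion p ∘ ≤bub-∈ʸ wv
      noInversion : ∀ {s t} → Before bottom (inj₁ s) (inj₂ t) → ¬ Before w (inj₂ t) (inj₁ s)
      noInversion {s} st ts with s ≟ x
      ... | yes refl = deletion-blocked p q x hq su uw wv x∈w st ts
      ... | no s≢x   = Before-asym (proj₁ su) st (Before-insertion p tsᵥ)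
        where
        tsᵥ : Before top (inj₂ _) (inj₁ s)
        tsᵥ = ≤bub-Before wv ts (∈-deletion p (Before⇒∈ʳ st) λ ())
                                (∈-deletion p (Before⇒∈ˡ st) (s≢x ∘ inj₁-injective)) λ ()
    ... | no x∉w = inj₂ (≤bub-≡ sw wv keepX keepY noInversion)
      where
      sw : Shuf m n w
      sw = ≤bub-Shuf uw su
      keepX : ∀ {s} → inj₁ s ∈ w → inj₁ s ∈ top
      keepX s∈ = ∈-deletion p (≤bub-∈ˣ uw s∈) λ { refl → x∉w s∈ }
      keepY : ∀ {t} → inj₂ t ∈ top → inj₂ t ∈ w
      keepY = ≤bub-∈ʸ uw ∘ ∈-insertion p
      noInversion : ∀ {s t} → Before w (inj₁ s) (inj₂ t) → ¬ Before top (inj₂ t) (inj₁ s)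
      noInversion st ts =
        Before-asym (proj₁ sw) st
          (≤bub-Before uw (Before-insertion p ts) (Before⇒∈ʳ st) (Before⇒∈ˡ st) λ ())

  swap-⋖bub : ∀ p q x y → Shuf m n (p ++ inj₁ x ∷ inj₂ y ∷ q) →
              (p ++ inj₁ x ∷ inj₂ y ∷ q) ⋖bub (p ++ inj₂ y ∷ inj₁ x ∷ q)
  swap-⋖bub p q x y su = Step⇒⋖bub (su , Shuf-swapˣʸ p su , trans p x y q) between
    where
    bottom top : Word m n
    bottom = p ++ inj₁ x ∷ inj₂ y ∷ q
    top = p ++ inj₂ y ∷ inj₁ x ∷ q
    between : NothingBetween bottom top
    between w uw wv with Before-total (≤bub-∈ˣ wv (∈-++⁺ʳ p (there (here refl))))
                                      (≤bub-∈ʸ uw (∈-++⁺ʳ p (there (here refl)))) (λ ())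
    ... | inj₁ xy =
      inj₁ (sym (≤bub-≡ su uw (≤bub-∈ˣ wv ∘ ∈-swap p) (∈-swap p ∘ ≤bub-∈ʸ wv)
                              noInversion))
      where
      noInversion : ∀ {s t} → Before bottom (inj₁ s) (inj₂ t) → ¬ Before w (inj₂ t) (inj₁ s)
      noInversion st ts
        with Before-swap p (≤bub-Before wv ts (∈-swap p (Before⇒∈ʳ st))
                                              (∈-swap p (Before⇒∈ˡ st)) λ ())
      ... | inj₁ (refl , refl) = Before-asym (proj₁ (≤bub-Shuf uw su)) xy ts
      ... | inj₂ tsᵤ           = Before-asym (proj₁ su) st tsᵤ
    ... | inj₂ yx =
      inj₂ (≤bub-≡ sw wv (∈-swap p ∘ ≤bub-∈ˣ uw) (≤bub-∈ʸ uw ∘ ∈-swap p) noInversion)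
      where
      sw : Shuf m n w
      sw = ≤bub-Shuf uw su
      noInversion : ∀ {s t} → Before w (inj₁ s) (inj₂ t) → ¬ Before top (inj₂ t) (inj₁ s)
      noInversion st ts with Before-swap p ts
      ... | inj₁ (refl , refl) = Before-asym (proj₁ sw) st yx
      ... | inj₂ tsᵤ           = Before-asym (proj₁ sw) st
                                   (≤bub-Before uw tsᵤ (Before⇒∈ʳ st) (Before⇒∈ˡ st) λ ())

  insY-⋖bub : ∀ p q y → HeadIsY q → Shuf m n (p ++ inj₂ y ∷ q) →
              (p ++ q) ⋖bub (p ++ inj₂ y ∷ q)
  insY-⋖bub p q y hq sv = Step⇒⋖bub (su , sv , insY p y q) between
    where
    bottom top : Word m n
    bottom = p ++ q
    top = p ++ inj₂ y ∷ q
    su : Shuf m n bottom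
    su = Shuf-deletion p sv
    between : NothingBetween bottom top
    between w uw wv with inj₂ y ∈? w
    ... | yes y∈w = inj₂ (≤bub-≡ sw wv (∈-insertion p ∘ ≤bub-∈ˣ uw) keepY noInversion)
      where
      sw : Shuf m n w
      sw = ≤bub-Shuf uw su
      keepY : ∀ {t} → inj₂ t ∈ top → inj₂ t ∈ w
      keepY {t} t∈ with t ≟ y
      ... | yes refl = y∈w
      ... | no t≢y   = ≤bub-∈ʸ uw (∈-deletion p t∈ (t≢y ∘ inj₂-injective))
      noInversion : ∀ {s t} → Before w (inj₁ s) (inj₂ t) → ¬ Before top (inj₂ t) (inj₁ s)
      noInversion {t = t} st ts with t ≟ y
      ... | yes refl = insertion-blocked p q y hq sv uw wv st ts
      ... | no t≢y   = Before-asym (proj₁ sw) st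
                         (≤bub-Before uw (Before-deletion p ts (t≢y ∘ inj₂-injective) λ ())
                                         (Before⇒∈ʳ st) (Before⇒∈ˡ st) λ ())
    ... | no y∉w = inj₁ (sym (≤bub-≡ su uw (≤bub-∈ˣ wv ∘ ∈-insertion p) keepY noInversion))
      where
      keepY : ∀ {t} → inj₂ t ∈ w → inj₂ t ∈ bottom
      keepY t∈ = ∈-deletion p (≤bub-∈ʸ wv t∈) λ { refl → y∉w t∈ }
      noInversion : ∀ {s t} → Before bottom (inj₁ s) (inj₂ t) → ¬ Before w (inj₂ t) (inj₁ s)
      noInversion st ts = Before-asym (proj₁ su) st (Before-deletion p tsᵥ t≢y λ ())
        where
        tsᵥ : Before top (inj₂ _) (inj₁ _)
        tsᵥ = ≤bub-Before wv ts (∈-insertion p (Before⇒∈ʳ st)) (∈-insertion p (Before⇒∈ˡ st))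
                             λ ()
        t≢y : inj₂ _ ≢ inj₂ y
        t≢y refl = Unique-deletion⇒∉ p (proj₁ sv) (Before⇒∈ʳ st)

  -- Lower covers containing a missing X-letter

  ⋖bub-delX⇒HeadIsX : ∀ p q x → Shuf m n (p ++ inj₁ x ∷ q) →
                      (p ++ inj₁ x ∷ q) ⋖bub (p ++ q) → HeadIsX q
  ⋖bub-delX⇒HeadIsX p []           x _  _ = empty
  ⋖bub-delX⇒HeadIsX p (inj₁ s ∷ q) x _  _ = cons s q
  ⋖bub-delX⇒HeadIsX p (inj₂ t ∷ q) x su (_ , _ , between)
    with between (p ++ inj₂ t ∷ inj₁ x ∷ q) ((su , sw , trans p x t q) ◅ ε)
                 ((sw , Shuf-deletion p su , Move-++ p (delX [ inj₂ t ] x q)) ◅ ε)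
    where
    sw : Shuf m n (p ++ inj₂ t ∷ inj₁ x ∷ q)
    sw = Shuf-swapˣʸ p su
  ... | inj₁ w≡u with ++-cancelˡ p _ _ w≡u
  ...   | ()
  ⋖bub-delX⇒HeadIsX p (inj₂ t ∷ q) x su _ | inj₂ w≡v with ++-cancelˡ p _ _ w≡v
  ...   | ()

  insertion-point-unique : ∀ p p′ {q q′} x →
                           XSorted (p ++ inj₁ x ∷ q) → XSorted (p′ ++ inj₁ x ∷ q′) →
                           HeadIsX q → HeadIsX q′ → p ++ q ≡ p′ ++ q′ → p ≡ p′ × q ≡ q′
  insertion-point-unique []      []       x _ _ _ _ eq = refl , eq
  insertion-point-unique []      (c ∷ p′) x _ _ empty _ ()
  insertion-point-unique []      (c ∷ p′) x sorted sorted′ (cons s _) _ refl =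
    ⊥-elim (<-asym (sorted (first (here refl))) (sorted′ (first (∈-insert p′))))
  insertion-point-unique (c ∷ p) []       x _ _ _ empty ()
  insertion-point-unique (c ∷ p) []       x sorted sorted′ _ (cons s _) refl =
    ⊥-elim (<-asym (sorted′ (first (here refl))) (sorted (first (∈-insert p))))
  insertion-point-unique (c ∷ p) (c′ ∷ p′) x sorted sorted′ hq hq′ eq with ∷-injective eq
  ... | refl , eq′
    with insertion-point-unique p p′ x (sorted ∘ later) (sorted′ ∘ later) hq hq′ eq′
  ...   | refl , q≡q′ = refl , q≡q′

  ⋖bub-containing-unique : ∀ x p q {u′ v} → Shuf m n (p ++ inj₁ x ∷ q) → HeadIsX q →
                           v ≡ p ++ q → inj₁ x ∉ v → u′ ⋖bub v → inj₁ x ∈ u′ →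
                           p ++ inj₁ x ∷ q ≡ u′
  ⋖bub-containing-unique x p q su hq v≡ x∉ cov x∈ with ⋖bub⇒Step cov
  ... | _ , _ , insY p′ _ _    = ⊥-elim (x∉ (∈-insertion p′ x∈))
  ... | _ , _ , trans p′ _ _ _ = ⊥-elim (x∉ (∈-swap p′ x∈))
  ... | su′ , _ , delX p′ a q′ with a ≟ x
  ...   | no a≢x   = ⊥-elim (x∉ (∈-deletion p′ x∈ (a≢x ∘ sym ∘ inj₁-injective)))
  ...   | yes refl
    with insertion-point-unique p p′ x (Shuf⇒XSorted su) (Shuf⇒XSorted su′) hq
                                (⋖bub-delX⇒HeadIsX p′ q′ x su′ cov) (sym v≡)
  ...     | refl , refl = refl

  ∃!-⋖bub-containing : ∀ v → Shuf m n v → ∀ x → inj₁ x ∉ v →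
                       ∃! _≡_ (λ u → (u ⋖bub v) × (inj₁ x ∈ u))
  ∃!-⋖bub-containing v sv x x∉ with insertion-point x sv x∉
  ... | p , q , refl , hq , su =
    p ++ inj₁ x ∷ q , (delX-⋖bub p q x hq su sv , ∈-++⁺ʳ p (here refl)) ,
    λ (cov , x∈) → ⋖bub-containing-unique x p q su hq refl x∉ cov x∈

  -- Lower covers at a present Y-letter

  DropsOrUnswaps : Fin n → Word m n → Word m n → Set
  DropsOrUnswaps y v u =
    (inj₂ y ∉ u) ⊎
    (∃[ c ] ∃[ p ] ∃[ q ] (v ≡ p ++ inj₂ y ∷ c ∷ q) ×
      ((xPart u ≡ xPart v) × (yPart u ≡ yPart v) ×
       (∀ s t → (Inv u s t → Inv v s t × ¬ (inj₁ s ≡ c × t ≡ y))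
              × (Inv v s t × ¬ (inj₁ s ≡ c × t ≡ y) → Inv u s t))))

  LowerCoverAt : Fin n → Word m n → Word m n → Set
  LowerCoverAt y v u = (u ⋖bub v) × DropsOrUnswaps y v u

  swap-DropsOrUnswaps : ∀ p q x y → Shuf m n (p ++ inj₁ x ∷ inj₂ y ∷ q) →
                        DropsOrUnswaps y (p ++ inj₂ y ∷ inj₁ x ∷ q) (p ++ inj₁ x ∷ inj₂ y ∷ q)
  swap-DropsOrUnswaps p q x y su =
    inj₂ (inj₁ x , p , q , refl , xPart-swap p , yPart-swap p , λ _ _ → kept , restored)
    where
    bottom top : Word m n
    bottom = p ++ inj₁ x ∷ inj₂ y ∷ q
    top = p ++ inj₂ y ∷ inj₁ x ∷ q
    kept : ∀ {s t} → Inv bottom s t → Inv top s t × ¬ (inj₁ s ≡ inj₁ x × t ≡ y)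
    kept inv with Before-swap p (split⇒Before inv)
    ... | inj₁ (() , _)
    ... | inj₂ ts = Before⇒split ts , λ { (refl , refl) →
                      Before-asym (proj₁ su) (Before-++⁺ʳ p (first (here refl))) (split⇒Before inv) }
    restored : ∀ {s t} → Inv top s t × ¬ (inj₁ s ≡ inj₁ x × t ≡ y) → Inv bottom s t
    restored (inv , ¬xy) with Before-swap p (split⇒Before inv)
    ... | inj₁ (refl , refl) = ⊥-elim (¬xy (refl , refl))
    ... | inj₂ ts            = Before⇒split ts

  DropsOrUnswaps-Step : ∀ y {u v} → inj₂ y ∈ v → Step m n u v → DropsOrUnswaps y v u →
                        (∃[ p ] ∃[ q ] (u ≡ p ++ q × v ≡ p ++ inj₂ y ∷ q)) ⊎
                        (∃[ p ] ∃[ s ] ∃[ q ] (u ≡ p ++ inj₁ s ∷ inj₂ y ∷ q ×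
                                              v ≡ p ++ inj₂ y ∷ inj₁ s ∷ q))
  DropsOrUnswaps-Step y y∈ (_ , _ , delX p _ _) (inj₁ y∉) = ⊥-elim (y∉ (∈-insertion p y∈))
  DropsOrUnswaps-Step y y∈ (_ , _ , delX p _ _) (inj₂ (_ , _ , _ , _ , xs≡ , _)) =
    ⊥-elim (mapMaybe-deletion-≢ isInj₁ p refl xs≡)
  DropsOrUnswaps-Step y y∈ (_ , _ , insY p b q) (inj₂ (_ , _ , _ , _ , _ , ys≡ , _)) =
    ⊥-elim (mapMaybe-deletion-≢ isInj₂ p refl (sym ys≡))
  DropsOrUnswaps-Step y y∈ (_ , _ , insY p b q) (inj₁ y∉) with b ≟ y
  ... | yes refl = inj₁ (p , q , refl , refl)
  ... | no b≢y   = ⊥-elim (y∉ (∈-deletion p y∈ (b≢y ∘ sym ∘ inj₂-injective)))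
  DropsOrUnswaps-Step y y∈ (_ , _ , trans p _ _ _) (inj₁ y∉) = ⊥-elim (y∉ (∈-swap p y∈))
  DropsOrUnswaps-Step y y∈ (su , _ , trans p a b q) (inj₂ (_ , _ , _ , _ , _ , _ , inversions))
    with b ≟ y
  ... | yes refl = inj₂ (p , a , q , refl , refl)
  ... | no b≢y   =
    ⊥-elim (Before-asym (proj₁ su) ab (split⇒Before (proj₂ (inversions a b) (ba , b≢y ∘ proj₂))))
    where
    ab : Before (p ++ inj₁ a ∷ inj₂ b ∷ q) (inj₁ a) (inj₂ b)
    ab = Before-++⁺ʳ p (first (here refl))
    ba : Inv (p ++ inj₂ b ∷ inj₁ a ∷ q) a b
    ba = Before⇒split (Before-++⁺ʳ p (first (here refl)))

  insY-before-X-not-⋖bub : ∀ p q s y → Shuf m n (p ++ inj₂ y ∷ inj₁ s ∷ q) →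
                           ¬ (p ++ inj₁ s ∷ q) ⋖bub (p ++ inj₂ y ∷ inj₁ s ∷ q)
  insY-before-X-not-⋖bub p q s y sv (_ , _ , between)
    with between (p ++ inj₁ s ∷ inj₂ y ∷ q)
                 ((Shuf-deletion p sv , sw , Move-++ p (insY [ inj₁ s ] y q)) ◅ ε)
                 ((sw , sv , trans p s y q) ◅ ε)
    where
    sw : Shuf m n (p ++ inj₁ s ∷ inj₂ y ∷ q)
    sw = Shuf-swapʸˣ p sv
  ... | inj₁ w≡u with ++-cancelˡ p _ _ w≡u
  ...   | ()
  insY-before-X-not-⋖bub p q s y sv _ | inj₂ w≡v with ++-cancelˡ p _ _ w≡v
  ...   | ()

  ∃!-LowerCoverAt-swap : ∀ p q s y → Shuf m n (p ++ inj₂ y ∷ inj₁ s ∷ q) →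
                         ∃! _≡_ (LowerCoverAt y (p ++ inj₂ y ∷ inj₁ s ∷ q))
  ∃!-LowerCoverAt-swap p q s y sv =
    p ++ inj₁ s ∷ inj₂ y ∷ q , (swap-⋖bub p q s y su , swap-DropsOrUnswaps p q s y su) , unique
    where
    su : Shuf m n (p ++ inj₁ s ∷ inj₂ y ∷ q)
    su = Shuf-swapʸˣ p sv
    unique : ∀ {u′} → LowerCoverAt y (p ++ inj₂ y ∷ inj₁ s ∷ q) u′ →
             p ++ inj₁ s ∷ inj₂ y ∷ q ≡ u′
    unique (cov , d) with DropsOrUnswaps-Step y (∈-++⁺ʳ p (here refl)) (⋖bub⇒Step cov) d
    ... | inj₁ (p′ , q′ , refl , v≡) with Unique-split p p′ (proj₁ sv) v≡
    ...   | refl , refl = ⊥-elim (insY-before-X-not-⋖bub p q s y sv cov)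
    unique _ | inj₂ (p′ , s′ , q′ , refl , v≡) with Unique-split p p′ (proj₁ sv) v≡
    ...   | refl , refl = refl

  ∃!-LowerCoverAt-deletion : ∀ p q y → HeadIsY q → Shuf m n (p ++ inj₂ y ∷ q) →
                             ∃! _≡_ (LowerCoverAt y (p ++ inj₂ y ∷ q))
  ∃!-LowerCoverAt-deletion p q y hq sv =
    p ++ q , (insY-⋖bub p q y hq sv , inj₁ (Unique-deletion⇒∉ p (proj₁ sv))) , unique
    where
    notX : ∀ {r s r′} → HeadIsY r → r ≢ inj₁ s ∷ r′
    notX empty      ()
    notX (cons _ _) ()
    unique : ∀ {u′} → LowerCoverAt y (p ++ inj₂ y ∷ q) u′ → p ++ q ≡ u′
    unique (cov , d) with DropsOrUnswaps-Step y (∈-++⁺ʳ p (here refl)) (⋖bub⇒Step cov) d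
    ... | inj₁ (p′ , q′ , refl , v≡) with Unique-split p p′ (proj₁ sv) v≡
    ...   | refl , refl = refl
    unique _ | inj₂ (p′ , s′ , q′ , refl , v≡) =
      ⊥-elim (notX hq (proj₂ (Unique-split p p′ (proj₁ sv) v≡)))

  ∃!-LowerCoverAt : ∀ v → Shuf m n v → ∀ y → inj₂ y ∈ v → ∃! _≡_ (LowerCoverAt y v)
  ∃!-LowerCoverAt v sv y y∈ with ∈-∃++ y∈
  ... | p , []         , refl = ∃!-LowerCoverAt-deletion p [] y empty sv
  ... | p , inj₂ t ∷ q , refl = ∃!-LowerCoverAt-deletion p (inj₂ t ∷ q) y (cons t q) sv
  ... | p , inj₁ s ∷ q , refl = ∃!-LowerCoverAt-swap p q s y sv

corollary3p7 : (m n : ℕ) (v : Word m n) → Shuf m n v → (x : Fin m) (y : Fin n) →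
    ((inj₁ x ∉ v) → ∃! _≡_ (λ u → (u ⋖bub v) × (inj₁ x ∈ u)))
    × ((inj₂ y ∈ v) → ∃! _≡_ (λ u → (u ⋖bub v) ×
         ((inj₂ y ∉ u) ⊎
          (∃[ c ] ∃[ p ] ∃[ q ] (v ≡ p ++ inj₂ y ∷ c ∷ q) ×
            ((xPart u ≡ xPart v) × (yPart u ≡ yPart v) ×
             (∀ s t → (Inv u s t → Inv v s t × ¬ (inj₁ s ≡ c × t ≡ y))
                    × (Inv v s t × ¬ (inj₁ s ≡ c × t ≡ y) → Inv u s t)))))))
corollary3p7 m n v sv x y = ∃!-⋖bub-containing v sv x , ∃!-LowerCoverAt v sv y
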